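{- Let $\mathcal{X}$ be a connected $n$-premaniplex with base flag $x_0$, $N=\mathrm{Stab}_{\mathcal{C}^n}(x_0)$, and let $(\mathcal{Y},\eta)$ be an $(n,m)$-voltage operator with $\mathcal{Y}$ connected, base flag $y_0$, $L=\mathrm{Stab}_{\mathcal{C}^m}(y_0)$ and $\zeta:L\to\mathcal{C}^n$, $\zeta(\omega)=\eta(P_\omega(y_0))$. (a) If $\mathcal{X}\rtimes_\eta\mathcal{Y}$ is connected and every automorphism of $\mathcal{X}\rtimes_\eta\mathcal{Y}$ is induced by an automorphism of $\mathcal{X}$, then $\mathrm{Norm}_{\mathcal{C}^m}(\zeta^{ -1}(N))\subseteq L$. (b) If $(\mathcal{Y},\eta)$ preserves connectivity and $\mathrm{Norm}_{\mathcal{C}^m}(\zeta^{ -1}(N))\subseteq L$, then every automorphism of $\mathcal{X}\rtimes_\eta\mathcal{Y}$ is induced by an automorphism of $\mathcal{X}$.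
   Context: A graph may have multiple edges and semi-edges. An $n$-premaniplex is such a graph with edges coloured by $\{0,\dots,n-1\}$ so that every vertex (flag) is the starting point of exactly one dart of each colour, and whenever $|i-j|\ge2$ every alternating path of length 4 with colours $i,j$ is closed; $x^i$ is the end of the $i$-dart at $x$. $\mathcal{C}^n=\langle r_0,\dots,r_{n-1}\mid r_i^2=1,\ (r_ir_j)^2=1\ (|i-j|\ge2)\rangle$ acts on the left on flags by $r_ix=x^i$; $\mathrm{Stab}$ denotes stabilisers and $\mathrm{Norm}$ normalisers. Automorphisms are bijections of flags preserving all $i$-adjacencies, acting on the right. For a flag $y$ of an $m$-premaniplex $\mathcal{Y}$ and $\omega\in\mathcal{C}^m$, $P_\omega(y)$ is the homotopy class of paths from $y$ whose successive colours $i_1,\dots,i_k$ satisfy $r_{i_k}\cdots r_{i_1}=\omega$ (homotopic iff same start and same element of $\mathcal{C}^m$); they end at $\omega y$; these form the fundamental groupoid $\Pi(\mathcal{Y})$. A voltage assignment $\eta:\Pi(\mathcal{Y})\to\mathcal{C}^n$ satisfies $\eta(W_1W_2)=\eta(W_2)\eta(W_1)$; $(\mathcal{Y},\eta)$ is an $(n,m)$-voltage operator. $\mathcal{X}\rtimes_\eta\mathcal{Y}$ is the $m$-premaniplex with flags $\mathcal{X}\times\mathcal{Y}$ and $(x,y)^i=(\eta(P_{r_i}(y))x,y^i)$, so $\omega(x,y)=(\eta(P_\omega(y))x,\omega y)$. The operator preserves connectivity if $\mathcal{X}'\rtimes_\eta\mathcal{Y}$ is connected for every connected $n$-premaniplex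 $\mathcal{X}'$. An automorphism of $\mathcal{X}\rtimes_\eta\mathcal{Y}$ is induced by $\sigma\in\mathrm{Aut}(\mathcal{X})$ if it equals $(x,y)\mapsto(x\sigma,y)$. Standing assumption: $\mathcal{Y}$ has a spanning tree all of whose darts have trivial voltage. -}

module Defs where

open import Data.Nat using (ℕ; _+_; _≤_)
open import Data.Fin using (Fin; toℕ)
open import Data.List using (List; []; _∷_; _++_; reverse)
open import Data.Product using (Σ; _×_; _,_; ∃; proj₁; proj₂)
open import Data.Sum using (_⊎_)
open import Data.Unit using (⊤)
open import Data.Empty using (⊥)
open import Relation.Nullary using (¬_)
open import Relation.Binary.PropositionalEquality using (_≡_; _≢_)

-- The group C^n = ⟨ r_0..r_{n-1} | r_i^2, (r_i r_j)^2 for |i-j|≥2 ⟩,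
-- presented by words with the congruence generated by the relations.
-- Convention: the word  a₁ ∷ a₂ ∷ … ∷ a_k ∷ []  denotes r_{a₁} r_{a₂} ⋯ r_{a_k},
-- so the product ω·ω' is  ω ++ ω'  and the identity is [].

Far : ∀ {n} → Fin n → Fin n → Set
Far i j = (2 + toℕ i ≤ toℕ j) ⊎ (2 + toℕ j ≤ toℕ i)

Word : ℕ → Set
Word n = List (Fin n)

gen : ∀ {n} → Fin n → Word n
gen i = i ∷ []

-- inverse in C^n (all generators are involutions)
winv : ∀ {n} → Word n → Word n
winv = reverse

infix 4 _≈w_
data _≈w_ {n : ℕ} : Word n → Word n → Set where
  ≈refl  : ∀ {u} → u ≈w u
  ≈sym   : ∀ {u v} → u ≈w v → v ≈w u
  ≈trans : ∀ {u v w} → u ≈w v → v ≈w w → u ≈w w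
  ≈invol : ∀ (a b : Word n) (i : Fin n) → (a ++ i ∷ i ∷ b) ≈w (a ++ b)
  ≈comm  : ∀ (a b : Word n) (i j : Fin n) → Far i j →
           (a ++ i ∷ j ∷ b) ≈w (a ++ j ∷ i ∷ b)

record RawPremaniplex (n : ℕ) : Set₁ where
  field
    Flag : Set
    r    : Fin n → Flag → Flag

  act : Word n → Flag → Flag
  act []      x = x
  act (i ∷ w) x = r i (act w x)

open RawPremaniplex public

record Premaniplex (n : ℕ) : Set₁ where
  field
    raw     : RawPremaniplex n
  field
    r-invol : ∀ i (x : Flag raw) → r raw i (r raw i x) ≡ x
    r-comm  : ∀ i j → Far i j → ∀ (x : Flag raw) →
              r raw i (r raw j (r raw i (r raw j x))) ≡ x

open Premaniplex public

Connected : ∀ {n} → RawPremaniplex n → Set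
Connected P = ∀ (x x' : Flag P) → Σ (Word _) λ w → act P w x ≡ x'

record Aut {n} (P : RawPremaniplex n) : Set where
  field
    fun   : Flag P → Flag P
    inv   : Flag P → Flag P
    left  : ∀ x → inv (fun x) ≡ x
    right : ∀ x → fun (inv x) ≡ x
    hom   : ∀ i x → fun (r P i x) ≡ r P i (fun x)

open Aut public

-- A homotopy class P_ω(y) in Π(Y) is the pair (y, ω)
-- with ω ∈ C^m (it ends at ω y).  A voltage assignment η : Π(Y) → C^n is a
-- map on such pairs, well defined on C^m, with η(W₁W₂) = η(W₂)η(W₁):
-- for W₁ = P_ω(y), W₂ = P_ω'(ωy) we have W₁W₂ = P_{ω'ω}(y).

record VoltageOp (n m : ℕ) : Set₁ where
  field
    Y      : Premaniplex m
    η      : Flag (raw Y) → Word m → Word n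
    η-resp : ∀ y {ω ω'} → ω ≈w ω' → η y ω ≈w η y ω'
    η-comp : ∀ y (ω ω' : Word m) →
             η y (ω' ++ ω) ≈w (η (act (raw Y) ω y) ω' ++ η y ω)

open VoltageOp public

_⋊_ : ∀ {n m} → Premaniplex n → VoltageOp n m → RawPremaniplex m
X ⋊ V = record
  { Flag = Flag (raw X) × Flag (raw (Y V))
  ; r    = λ i xy → act (raw X) (η V (proj₂ xy) (gen i)) (proj₁ xy)
                  , r (raw (Y V)) i (proj₂ xy) }

PreservesConnectivity : ∀ {n m} → VoltageOp n m → Set₁
PreservesConnectivity {n} V =
  ∀ (X' : Premaniplex n) → Connected (raw X') → Connected (X' ⋊ V)

InducedFromX : ∀ {n m} (X : Premaniplex n) (V : VoltageOp n m) → Aut (X ⋊ V) → Set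
InducedFromX X V φ =
  Σ (Aut (raw X)) λ σ → ∀ x y → fun φ (x , y) ≡ (fun σ x , y)

-- Spanning trees with trivial voltage (standing assumption).
-- A set T of darts (y,i) (closed under reversal) is a spanning tree if
-- every flag is reachable from y₀ by a walk using darts of T, and there is
-- no nonempty closed walk in T without backtracking (backtracking = two
-- consecutive darts of the same colour, since the reverse of the i-dart at y
-- is the i-dart at y^i).

walkEnd : ∀ {m} (P : RawPremaniplex m) → Flag P → List (Fin m) → Flag P
walkEnd P y []       = y
walkEnd P y (i ∷ cs) = walkEnd P (r P i y) cs

InWalk : ∀ {m} (P : RawPremaniplex m) → (Flag P → Fin m → Set) →
         Flag P → List (Fin m) → Set
InWalk P T y []       = ⊤
InWalk P T y (i ∷ cs) = T y i × InWalk P T (r P i y) cs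

NoBacktrack : ∀ {m} → List (Fin m) → Set
NoBacktrack []           = ⊤
NoBacktrack (i ∷ [])     = ⊤
NoBacktrack (i ∷ j ∷ cs) = (i ≢ j) × NoBacktrack (j ∷ cs)

record SpanningTree {m} (P : RawPremaniplex m) (y₀ : Flag P) : Set₁ where
  field
    T        : Flag P → Fin m → Set
    T-sym    : ∀ y i → T y i → T (r P i y) i
    spanning : ∀ y → Σ (List (Fin m)) λ cs → InWalk P T y₀ cs × walkEnd P y₀ cs ≡ y
    acyclic  : ∀ y (i : Fin m) (cs : List (Fin m)) →
               InWalk P T y (i ∷ cs) → NoBacktrack (i ∷ cs) →
               ¬ (walkEnd P y (i ∷ cs) ≡ y)

open SpanningTree public

HasTrivialSpanningTree : ∀ {n m} (V : VoltageOp n m) → Flag (raw (Y V)) → Set₁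
HasTrivialSpanningTree V y₀ =
  Σ (SpanningTree (raw (Y V)) y₀) λ S →
    ∀ y i → T S y i → η V y (gen i) ≈w []

InNormaliser : ∀ {m} → (Word m → Set) → Word m → Set
InNormaliser H g =
  ∀ h → (H h → H (g ++ h ++ winv g)) × (H (g ++ h ++ winv g) → H h)

ζPreimageN : ∀ {n m} (X : Premaniplex n) (x₀ : Flag (raw X))
             (V : VoltageOp n m) (y₀ : Flag (raw (Y V))) → Word m → Set
ζPreimageN X x₀ V y₀ ω =
  (act (raw (Y V)) ω y₀ ≡ y₀) × (act (raw X) (η V y₀ ω) x₀ ≡ x₀)

NormInL : ∀ {n m} (X : Premaniplex n) (x₀ : Flag (raw X))
          (V : VoltageOp n m) (y₀ : Flag (raw (Y V))) → Set
NormInL X x₀ V y₀ =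
  ∀ g → InNormaliser (ζPreimageN X x₀ V y₀) g → act (raw (Y V)) g y₀ ≡ y₀

-- ζ⁻¹(N) is the stabiliser in C^m of the base flag b = (x₀, y₀) of 𝒳 ⋊ 𝒴, and in a
-- connected premaniplex an automorphism sending b to c exists exactly when
-- Stab(b) = Stab(c); for c = g⁻¹b this says that g normalises Stab(b).
-- (a) A normalising g thus gives an automorphism b ↦ g⁻¹b; if it is induced it
-- fixes the 𝒴-coordinate, so g ∈ L.  (b) An automorphism φ gives such a g with
-- g⁻¹b = φb, and g ∈ L says that φ keeps the fibre over y₀, hence every fibre.
-- Along the trivial-voltage spanning tree φ then acts as one map σ on all fibres,
-- and σ commutes with each r_i because preserving connectivity, applied to the
-- universal premaniplex, makes ζ surjective.

module Submission where

open import Defs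
open import Data.Nat using (ℕ; suc; _+_; _≤_; _<_)
open import Data.Nat.Properties
  using (<-cmp; <-trans; <⇒≤; ≤-pred; m≤n⇒m<n∨m≡n; ≤-trans; ≤-reflexive; n≤1+n; <-irrefl; 1+n≰n; <-asym; _<?_; _≟_)
open import Data.Fin using (Fin; toℕ)
open import Data.Fin.Properties using (toℕ-injective)
open import Data.List using ([]; _∷_; _++_; reverse)
open import Data.List.Properties using (++-identityʳ; unfold-reverse; reverse-involutive)
open import Data.List.Relation.Unary.Linked using (Linked; []; [-]; _∷_; tail; linked?)
open import Data.Product using (Σ; _×_; _,_; proj₁; proj₂; swap)
open import Data.Sum using (_⊎_; inj₁; inj₂)
open import Data.Empty using (⊥-elim)
open import Function using (_⇔_; mk⇔; Equivalence)
open import Relation.Binary using (tri<; tri≈; tri>)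
open import Relation.Nullary using (¬_; Dec)
open import Relation.Nullary.Decidable using (_⊎-dec_; recompute)
open import Relation.Unary using (Pred; _⊆′_; _≐′_)
open import Relation.Binary.PropositionalEquality
open ≡-Reasoning

≈w-∷ : ∀ {n} (i : Fin n) {u v : Word n} → u ≈w v → (i ∷ u) ≈w (i ∷ v)
≈w-∷ i ≈refl              = ≈refl
≈w-∷ i (≈sym p)           = ≈sym (≈w-∷ i p)
≈w-∷ i (≈trans p q)       = ≈trans (≈w-∷ i p) (≈w-∷ i q)
≈w-∷ i (≈invol a b j)     = ≈invol (i ∷ a) b j
≈w-∷ i (≈comm a b j k f)  = ≈comm (i ∷ a) b j k f

far-relation : ∀ {n} {i j : Fin n} → Far i j → (i ∷ j ∷ i ∷ j ∷ []) ≈w []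
far-relation {i = i} {j} f =
  ≈trans (≈comm [] (i ∷ j ∷ []) i j f) (≈trans (≈invol (j ∷ []) (j ∷ []) i) (≈invol [] [] j))

act-++ : ∀ {n} (P : RawPremaniplex n) (u v : Word n) x → act P (u ++ v) x ≡ act P u (act P v x)
act-++ P []      v x = refl
act-++ P (i ∷ u) v x = cong (r P i) (act-++ P u v x)

module _ {n} (P : Premaniplex n) where
  private R = raw P

  r-swap : ∀ i j → Far i j → ∀ x → r R i (r R j x) ≡ r R j (r R i x)
  r-swap i j f x = begin
    r R i (r R j x)                             ≡⟨ cong (λ t → r R i (r R j t)) (sym (r-invol P i x)) ⟩
    r R i (r R j (r R i (r R i x)))             ≡⟨ cong (λ t → r R i (r R j (r R i t))) (sym (r-invol P j _)) ⟩
    r R i (r R j (r R i (r R j (r R j (r R i x))))) ≡⟨ r-comm P i j f _ ⟩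
    r R j (r R i x)                             ∎

  act-cong : ∀ {u v} → u ≈w v → ∀ x → act R u x ≡ act R v x
  act-cong ≈refl              x = refl
  act-cong (≈sym p)           x = sym (act-cong p x)
  act-cong (≈trans p q)       x = trans (act-cong p x) (act-cong q x)
  act-cong (≈invol a b i)     x = begin
    act R (a ++ i ∷ i ∷ b) x       ≡⟨ act-++ R a _ x ⟩
    act R a (r R i (r R i (act R b x))) ≡⟨ cong (act R a) (r-invol P i _) ⟩
    act R a (act R b x)            ≡⟨ act-++ R a b x ⟨
    act R (a ++ b) x               ∎
  act-cong (≈comm a b i j f)  x = begin
    act R (a ++ i ∷ j ∷ b) x       ≡⟨ act-++ R a _ x ⟩
    act R a (r R i (r R j (act R b x))) ≡⟨ cong (act R a) (r-swap i j f _) ⟩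
    act R a (r R j (r R i (act R b x))) ≡⟨ act-++ R a _ x ⟨
    act R (a ++ j ∷ i ∷ b) x       ∎

  act-winv-act : ∀ g x → act R (winv g) (act R g x) ≡ x
  act-winv-act []      x = refl
  act-winv-act (i ∷ g) x = begin
    act R (reverse (i ∷ g)) (r R i (act R g x))      ≡⟨ cong (λ w → act R w (r R i (act R g x))) (unfold-reverse i g) ⟩
    act R (reverse g ++ i ∷ []) (r R i (act R g x))  ≡⟨ act-++ R (reverse g) _ _ ⟩
    act R (reverse g) (r R i (r R i (act R g x)))    ≡⟨ cong (act R (reverse g)) (r-invol P i _) ⟩
    act R (reverse g) (act R g x)                    ≡⟨ act-winv-act g x ⟩
    x                                                ∎

  act-act-winv : ∀ g x → act R g (act R (winv g) x) ≡ x
  act-act-winv g x =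
    subst (λ h → act R h (act R (winv g) x) ≡ x) (reverse-involutive g) (act-winv-act (winv g) x)

-- The universal n-premaniplex: C^n acting on itself, with flags the normal
-- words, in which consecutive letters i j satisfy i < j or i = j + 1.
module Universal (n : ℕ) where

  Adj : Fin n → Fin n → Set
  Adj i j = toℕ i < toℕ j ⊎ toℕ i ≡ suc (toℕ j)

  Normal : Word n → Set
  Normal = Linked Adj

  normal? : ∀ w → Dec (Normal w)
  normal? = linked? (λ i j → toℕ i <? toℕ j ⊎-dec toℕ i ≟ suc (toℕ j))

  Above : Fin n → Fin n → Set
  Above i j = 2 + toℕ j ≤ toℕ i

  above⇒> : ∀ {i j} → Above i j → toℕ j < toℕ i
  above⇒> p = ≤-trans (n≤1+n _) p

  above-irrefl : ∀ {i} → ¬ Above i i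
  above-irrefl p = <-irrefl refl (above⇒> p)

  adj-irrefl : ∀ {i} → ¬ Adj i i
  adj-irrefl (inj₁ i<i) = <-irrefl refl i<i
  adj-irrefl (inj₂ e)   = 1+n≰n (≤-reflexive (sym e))

  above⇒¬adj : ∀ {i j} → Above i j → ¬ Adj i j
  above⇒¬adj p (inj₁ i<j) = <-asym i<j (above⇒> p)
  above⇒¬adj p (inj₂ e)   = 1+n≰n (≤-trans p (≤-reflexive e))

  above-adj⇒< : ∀ {i j k} → Above i j → Adj i k → toℕ j < toℕ k
  above-adj⇒< p (inj₁ i<k)  = <-trans (above⇒> p) i<k
  above-adj⇒< p (inj₂ e)    = ≤-pred (≤-trans p (≤-reflexive e))

  data Position (i j : Fin n) : Set where
    cancels : i ≡ j → Position i j
    passes  : Above i j → Position i j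
    stays   : Adj i j → Position i j

  position : ∀ i j → Position i j
  position i j with <-cmp (toℕ i) (toℕ j)
  ... | tri< i<j _ _ = stays (inj₁ i<j)
  ... | tri≈ _ i≡j _ = cancels (toℕ-injective i≡j)
  ... | tri> _ _ j<i with m≤n⇒m<n∨m≡n j<i
  ...   | inj₁ 2+j≤i = passes 2+j≤i
  ...   | inj₂ 1+j≡i = stays (inj₂ (sym 1+j≡i))

  -- ρ i w is the normal form of r_i w for normal w.
  ρ : Fin n → Word n → Word n
  ρ i []      = i ∷ []
  ρ i (j ∷ w) with position i j
  ... | cancels _ = w
  ... | passes _  = j ∷ ρ i w
  ... | stays _   = i ∷ j ∷ w

  ρ-cancels : ∀ i w → ρ i (i ∷ w) ≡ w
  ρ-cancels i w with position i i
  ... | cancels _ = refl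
  ... | passes p  = ⊥-elim (above-irrefl p)
  ... | stays a   = ⊥-elim (adj-irrefl a)

  ρ-passes : ∀ {i j} w → Above i j → ρ i (j ∷ w) ≡ j ∷ ρ i w
  ρ-passes {i} {j} w p with position i j
  ... | cancels refl = ⊥-elim (above-irrefl p)
  ... | passes _     = refl
  ... | stays a      = ⊥-elim (above⇒¬adj p a)

  ρ-stays : ∀ {i j} w → Adj i j → ρ i (j ∷ w) ≡ i ∷ j ∷ w
  ρ-stays {i} {j} w a with position i j
  ... | cancels refl = ⊥-elim (adj-irrefl a)
  ... | passes p     = ⊥-elim (above⇒¬adj p a)
  ... | stays _      = refl

  ρ-normal-cons : ∀ {i w} → Normal (i ∷ w) → ρ i w ≡ i ∷ w
  ρ-normal-cons [-]     = refl
  ρ-normal-cons (a ∷ _) = ρ-stays _ a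

  normal-lower-head : ∀ {i j w} → Above i j → Normal (i ∷ w) → Normal (j ∷ w)
  normal-lower-head p [-]     = [-]
  normal-lower-head p (a ∷ q) = inj₁ (above-adj⇒< p a) ∷ q

  ρ-normal-passes : ∀ {i j} w → Above i j → Normal (j ∷ w) → Normal (j ∷ ρ i w)
  ρ-normal-passes []          p _       = inj₁ (above⇒> p) ∷ [-]
  ρ-normal-passes {i} (k ∷ w) p (a ∷ q) with position i k
  ... | cancels refl = normal-lower-head p q
  ... | passes pk    = a ∷ ρ-normal-passes w pk q
  ... | stays b      = inj₁ (above⇒> p) ∷ b ∷ q

  ρ-normal : ∀ i {w} → Normal w → Normal (ρ i w)
  ρ-normal i []              = [-]
  ρ-normal i {j ∷ w} q with position i j
  ... | cancels refl = tail q
  ... | passes p     = ρ-normal-passes w p q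
  ... | stays a      = a ∷ q

  ρ-involutive : ∀ i {w} → Normal w → ρ i (ρ i w) ≡ w
  ρ-involutive i []              = ρ-cancels i []
  ρ-involutive i {j ∷ w} q with position i j
  ... | cancels refl = ρ-normal-cons q
  ... | passes p     = trans (ρ-passes _ p) (cong (j ∷_) (ρ-involutive i (tail q)))
  ... | stays _      = ρ-cancels i (j ∷ w)

  ρ-comm-cons : ∀ {i j} {v} → Above i j → Normal (j ∷ v) → ρ i (j ∷ v) ≡ ρ j (ρ i v)
  ρ-comm-cons {v = v} p q =
    trans (ρ-passes v p) (sym (ρ-normal-cons (ρ-normal-passes v p q)))

  ρ-comm : ∀ {i j} {v} → Above i j → Normal v → ρ i (ρ j v) ≡ ρ j (ρ i v)
  ρ-comm p [] = ρ-comm-cons p [-]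
  ρ-comm {i} {j} {k ∷ v} p q with position j k
  ... | cancels refl = sym (trans (cong (ρ j) (ρ-passes v p)) (ρ-cancels j (ρ i v)))
  ... | stays a      = ρ-comm-cons p (a ∷ q)
  ... | passes pk    = begin
    ρ i (k ∷ ρ j v)   ≡⟨ ρ-passes _ i-above-k ⟩
    k ∷ ρ i (ρ j v)   ≡⟨ cong (k ∷_) (ρ-comm p (tail q)) ⟩
    k ∷ ρ j (ρ i v)   ≡⟨ ρ-passes _ pk ⟨
    ρ j (k ∷ ρ i v)   ≡⟨ cong (ρ j) (ρ-passes v i-above-k) ⟨
    ρ j (ρ i (k ∷ v)) ∎
    where
    i-above-k : Above i k
    i-above-k = ≤-trans pk (<⇒≤ (above⇒> p))

  ρ-sound : ∀ i w → ρ i w ≈w (i ∷ w)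
  ρ-sound i []      = ≈refl
  ρ-sound i (j ∷ w) with position i j
  ... | cancels refl = ≈sym (≈invol [] w i)
  ... | passes p     = ≈trans (≈w-∷ j (ρ-sound i w)) (≈comm [] w j i (inj₁ p))
  ... | stays _      = ≈refl

  ρ-far-comm : ∀ {i j} {v} → Far i j → Normal v → ρ i (ρ j v) ≡ ρ j (ρ i v)
  ρ-far-comm (inj₁ p) q = sym (ρ-comm p q)
  ρ-far-comm (inj₂ p) q = ρ-comm p q

  -- Normality is irrelevant, so flags are equal as soon as their words are.
  record NormalWord : Set where
    constructor normalWord
    field
      word    : Word n
      .normal : Normal word

  open NormalWord

  normal! : ∀ z → Normal (word z)
  normal! (normalWord w p) = recompute (normal? w) p

  normalWord-cong : ∀ {w w'} .{p : Normal w} .{q : Normal w'} → w ≡ w' → normalWord w p ≡ normalWord w' q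
  normalWord-cong refl = refl

  U : Premaniplex n
  U = record
    { raw     = record { Flag = NormalWord ; r = rU }
    ; r-invol = λ i z → normalWord-cong (ρ-involutive i (normal! z))
    ; r-comm  = λ i j f z → normalWord-cong (ρ-far-relation f (normal! z))
    }
    where
    rU : Fin n → NormalWord → NormalWord
    rU i (normalWord w p) = normalWord (ρ i w) (ρ-normal i p)

    ρ-far-relation : ∀ {i j v} → Far i j → Normal v → ρ i (ρ j (ρ i (ρ j v))) ≡ v
    ρ-far-relation {i} {j} {v} f q = begin
      ρ i (ρ j (ρ i (ρ j v))) ≡⟨ cong (ρ i) (ρ-far-comm f (ρ-normal j q)) ⟨
      ρ i (ρ i (ρ j (ρ j v))) ≡⟨ ρ-involutive i (ρ-normal j (ρ-normal j q)) ⟩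
      ρ j (ρ j v)             ≡⟨ ρ-involutive j q ⟩
      v                       ∎

  base : NormalWord
  base = normalWord [] []

  word-act : ∀ c z → word (act (raw U) c z) ≈w (c ++ word z)
  word-act []      z = ≈refl
  word-act (i ∷ c) z = ≈trans (ρ-sound i _) (≈w-∷ i (word-act c z))

  act-base-injective : ∀ {c d} → act (raw U) c base ≡ act (raw U) d base → c ≈w d
  act-base-injective {c} {d} e = ≈trans (≈sym (from-base c)) (subst (λ z → word z ≈w d) (sym e) (from-base d))
    where
    from-base : ∀ c → word (act (raw U) c base) ≈w c
    from-base c = subst (word (act (raw U) c base) ≈w_) (++-identityʳ c) (word-act c base)

  act-normal-base : ∀ {w} (q : Normal w) → act (raw U) w base ≡ normalWord w q
  act-normal-base []          = refl
  act-normal-base {i ∷ w} q   =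
    normalWord-cong (trans (cong (λ z → ρ i (word z)) (act-normal-base (tail q))) (ρ-normal-cons q))

  U-connected : Connected (raw U)
  U-connected z z' = word z' ++ winv (word z) , (begin
    act (raw U) (word z' ++ winv (word z)) z       ≡⟨ act-++ (raw U) (word z') _ z ⟩
    act (raw U) (word z') (act (raw U) (winv (word z)) z)
      ≡⟨ cong (λ t → act (raw U) (word z') (act (raw U) (winv (word z)) t)) (act-normal-base (normal! z)) ⟨
    act (raw U) (word z') (act (raw U) (winv (word z)) (act (raw U) (word z) base))
      ≡⟨ cong (act (raw U) (word z')) (act-winv-act U (word z) base) ⟩
    act (raw U) (word z') base                    ≡⟨ act-normal-base (normal! z') ⟩
    z'                                            ∎)

Stab : ∀ {n} (P : RawPremaniplex n) → Flag P → Pred (Word n) _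
Stab P a h = act P h a ≡ a

InNormaliser-cong : ∀ {m} {H K : Pred (Word m) _} → H ≐′ K → ∀ g → InNormaliser H g → InNormaliser K g
InNormaliser-cong (H⊆K , K⊆H) g N h = (λ k → H⊆K _ (proj₁ (N h) (K⊆H _ k))) , (λ k → H⊆K _ (proj₂ (N h) (K⊆H _ k)))

module _ {n} {P : RawPremaniplex n} (φ : Aut P) where

  Aut-act : ∀ u f → fun φ (act P u f) ≡ act P u (fun φ f)
  Aut-act []      f = refl
  Aut-act (i ∷ u) f = trans (hom φ i (act P u f)) (cong (r P i) (Aut-act u f))

  Aut-injective : ∀ {f f'} → fun φ f ≡ fun φ f' → f ≡ f'
  Aut-injective {f} {f'} e = trans (sym (left φ f)) (trans (cong (inv φ) e) (left φ f'))

  Stab-Aut : ∀ a → Stab P (fun φ a) ≐′ Stab P a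
  Stab-Aut a = (λ h s → Aut-injective (trans (Aut-act h a) s))
             , (λ h s → trans (sym (Aut-act h a)) (cong (fun φ) s))

module _ {n} (P : Premaniplex n) where
  private R = raw P

  act-winv-≡ : ∀ g {f c} → act R g f ≡ c → act R (winv g) c ≡ f
  act-winv-≡ g {f} refl = act-winv-act P g f

  Stab-winv : ∀ a g → Stab R a (winv g) ⇔ Stab R a g
  Stab-winv a g = mk⇔ (λ s → trans (cong (act R g) (sym s)) (act-act-winv P g a)) (act-winv-≡ g)

  Stab-conj : ∀ a g h → Stab R a (g ++ h ++ winv g) ⇔ Stab R (act R (winv g) a) h
  Stab-conj a g h = mk⇔ (λ s → sym (act-winv-≡ g (trans (sym act-conj) s)))
                        (λ s → trans act-conj (trans (cong (act R g) s) (act-act-winv P g a)))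
    where
    act-conj : act R (g ++ h ++ winv g) a ≡ act R g (act R h (act R (winv g) a))
    act-conj = trans (act-++ R g _ a) (cong (act R g) (act-++ R h _ a))

  InNormaliser-Stab⇔ : ∀ a g → InNormaliser (Stab R a) g ⇔ (Stab R a ≐′ Stab R (act R (winv g) a))
  InNormaliser-Stab⇔ a g = mk⇔
    (λ N → (λ h s → to (Stab-conj a g h) (proj₁ (N h) s)) , (λ h s → proj₂ (N h) (from (Stab-conj a g h) s)))
    (λ (⊆ , ⊇) h → (λ s → from (Stab-conj a g h) (⊆ h s)) , (λ s → ⊇ h (to (Stab-conj a g h) s)))
    where open Equivalence

  module _ (connected : Connected R) where

    path : Flag R → Flag R → Word n
    path a f = proj₁ (connected a f)

    act-path : ∀ a f → act R (path a f) a ≡ f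
    act-path a f = proj₂ (connected a f)

    Stab⊆⇒act-resp : ∀ {a c} → Stab R a ⊆′ Stab R c → ∀ {u v} → act R u a ≡ act R v a → act R u c ≡ act R v c
    Stab⊆⇒act-resp {a} {c} a⊆c {u} {v} e = begin
      act R u c                           ≡⟨ act-act-winv P v _ ⟨
      act R v (act R (winv v) (act R u c)) ≡⟨ cong (act R v) (trans (sym (act-++ R (winv v) u c)) (a⊆c (winv v ++ u) vu∈Stab)) ⟩
      act R v c                           ∎
      where
      vu∈Stab : Stab R a (winv v ++ u)
      vu∈Stab = trans (act-++ R (winv v) u a) (act-winv-≡ v (sym e))

    transport : Flag R → Flag R → Flag R → Flag R
    transport a c f = act R (path a f) c

    transport-act : ∀ {a c} → Stab R a ⊆′ Stab R c → ∀ u → transport a c (act R u a) ≡ act R u c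
    transport-act {a} a⊆c u = Stab⊆⇒act-resp a⊆c {path a (act R u a)} {u} (act-path a (act R u a))

    Stab≐⇒Aut : ∀ {a c} → Stab R a ≐′ Stab R c → Σ (Aut R) λ ψ → fun ψ a ≡ c
    Stab≐⇒Aut {a} {c} (a⊆c , c⊆a) = ψ , transport-act {a} {c} a⊆c []
      where
      round-trip : ∀ {a c} → Stab R a ⊆′ Stab R c → Stab R c ⊆′ Stab R a → ∀ f → transport c a (transport a c f) ≡ f
      round-trip {a} {c} a⊆c c⊆a f = trans (transport-act c⊆a (path a f)) (act-path a f)

      ψ : Aut R
      ψ = record
        { fun   = transport a c
        ; inv   = transport c a
        ; left  = round-trip a⊆c c⊆a
        ; right = round-trip c⊆a a⊆c
        ; hom   = λ i f → begin
            transport a c (r R i f)                      ≡⟨ cong (λ t → transport a c (r R i t)) (act-path a f) ⟨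
            transport a c (act R (i ∷ path a f) a)       ≡⟨ transport-act {a} {c} a⊆c (i ∷ path a f) ⟩
            r R i (transport a c f)                      ∎
        }

module _ {n m} (P : Premaniplex n) (V : VoltageOp n m) where
  private
    RP = raw P
    RY = raw (Y V)

  -- η-comp makes η(P_{[]}(y)) an idempotent, hence trivial, permutation.
  η-[]-acts-trivially : ∀ y x → act RP (η V y []) x ≡ x
  η-[]-acts-trivially y x = begin
    act RP e x                                   ≡⟨ act-winv-act P e _ ⟨
    act RP (winv e) (act RP e (act RP e x))      ≡⟨ cong (act RP (winv e)) (sym idempotent) ⟩
    act RP (winv e) (act RP e x)                 ≡⟨ act-winv-act P e x ⟩
    x                                            ∎
    where
    e = η V y []
    idempotent : act RP e x ≡ act RP e (act RP e x)
    idempotent = trans (act-cong P (η-comp V y [] []) x) (act-++ RP e e x)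

  act-⋊ : ∀ u x y → act (P ⋊ V) u (x , y) ≡ (act RP (η V y u) x , act RY u y)
  act-⋊ []      x y = cong (_, y) (sym (η-[]-acts-trivially y x))
  act-⋊ (i ∷ u) x y = begin
    r (P ⋊ V) i (act (P ⋊ V) u (x , y))
      ≡⟨ cong (r (P ⋊ V) i) (act-⋊ u x y) ⟩
    (act RP (η V (act RY u y) (gen i)) (act RP (η V y u) x) , act RY (i ∷ u) y)
      ≡⟨ cong (_, _) (act-++ RP (η V (act RY u y) (gen i)) _ x) ⟨
    (act RP (η V (act RY u y) (gen i) ++ η V y u) x , act RY (i ∷ u) y)
      ≡⟨ cong (_, _) (act-cong P (η-comp V y u (gen i)) x) ⟨
    (act RP (η V y (i ∷ u)) x , act RY (i ∷ u) y)
      ∎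

  act-⋊-cong : ∀ {u v} → u ≈w v → ∀ f → act (P ⋊ V) u f ≡ act (P ⋊ V) v f
  act-⋊-cong {u} {v} u≈v (x , y) = begin
    act (P ⋊ V) u (x , y)                    ≡⟨ act-⋊ u x y ⟩
    (act RP (η V y u) x , act RY u y)        ≡⟨ cong₂ _,_ (act-cong P (η-resp V y u≈v) x) (act-cong (Y V) u≈v y) ⟩
    (act RP (η V y v) x , act RY v y)        ≡⟨ act-⋊ v x y ⟨
    act (P ⋊ V) v (x , y)                    ∎

  ⋊-premaniplex : Premaniplex m
  ⋊-premaniplex = record
    { raw     = P ⋊ V
    ; r-invol = λ i → act-⋊-cong (≈invol [] [] i)
    ; r-comm  = λ i j f → act-⋊-cong (far-relation f)
    }

-- Applied to the universal premaniplex, preserving connectivity makes ζ surjective.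
ζ-surjective : ∀ {n m} (V : VoltageOp n m) y₀ → PreservesConnectivity V →
               ∀ c → Σ (Word m) λ w → act (raw (Y V)) w y₀ ≡ y₀ × η V y₀ w ≈w c
ζ-surjective {n} V y₀ preserves c = w , cong proj₂ w-base , act-base-injective (cong proj₁ w-base)
  where
  open Universal n
  connected = preserves U U-connected (base , y₀) (act (raw U) c base , y₀)
  w = proj₁ connected
  w-base : (act (raw U) (η V y₀ w) base , act (raw (Y V)) w y₀) ≡ (act (raw U) c base , y₀)
  w-base = trans (sym (act-⋊ U V w base y₀)) (proj₂ connected)

module _ {n m} (X : Premaniplex n) (V : VoltageOp n m) where
  private
    RX  = raw X
    RY  = raw (Y V)
    RXV = X ⋊ V
    XV  = ⋊-premaniplex X V

  proj₂-act-⋊ : ∀ u f → proj₂ (act RXV u f) ≡ act RY u (proj₂ f)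
  proj₂-act-⋊ u (x , y) = cong proj₂ (act-⋊ X V u x y)

  Aut-preserves-fibres : Connected RXV → ∀ (φ : Aut RXV) b → proj₂ (fun φ b) ≡ proj₂ b →
                         ∀ f → proj₂ (fun φ f) ≡ proj₂ f
  Aut-preserves-fibres connected φ b φb f = begin
    proj₂ (fun φ f)                   ≡⟨ cong (λ t → proj₂ (fun φ t)) (act-path XV connected b f) ⟨
    proj₂ (fun φ (act RXV u b))       ≡⟨ cong proj₂ (Aut-act φ u b) ⟩
    proj₂ (act RXV u (fun φ b))       ≡⟨ proj₂-act-⋊ u _ ⟩
    act RY u (proj₂ (fun φ b))        ≡⟨ cong (act RY u) φb ⟩
    act RY u (proj₂ b)                ≡⟨ proj₂-act-⋊ u b ⟨
    proj₂ (act RXV u b)               ≡⟨ cong proj₂ (act-path XV connected b f) ⟩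
    proj₂ f                           ∎
    where u = path XV connected b f

  module _ (φ : Aut RXV) (fibres : ∀ f → proj₂ (fun φ f) ≡ proj₂ f) (y₀ : Flag RY) where

    σ : Flag RX → Flag RX
    σ x = proj₁ (fun φ (x , y₀))

    InducedAt : Flag RY → Set
    InducedAt y = ∀ x → fun φ (x , y) ≡ (σ x , y)

    induced-at-y₀ : InducedAt y₀
    induced-at-y₀ x = cong (σ x ,_) (fibres (x , y₀))

    InducedAt-trivial-dart : ∀ {y i} → η V y (gen i) ≈w [] → InducedAt y → InducedAt (r RY i y)
    InducedAt-trivial-dart {y} {i} trivial induced x = begin
      fun φ (x , r RY i y)           ≡⟨ cong (fun φ) (dart x) ⟨
      fun φ (r RXV i (x , y))        ≡⟨ hom φ i (x , y) ⟩
      r RXV i (fun φ (x , y))        ≡⟨ cong (r RXV i) (induced x) ⟩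
      r RXV i (σ x , y)              ≡⟨ dart (σ x) ⟩
      (σ x , r RY i y)               ∎
      where
      dart : ∀ x → r RXV i (x , y) ≡ (x , r RY i y)
      dart x = cong (_, r RY i y) (act-cong X trivial x)

    induced-everywhere : HasTrivialSpanningTree V y₀ → ∀ y → InducedAt y
    induced-everywhere (S , trivial) y with spanning S y
    ... | cs , in-tree , refl = along cs in-tree induced-at-y₀
      where
      along : ∀ {y} cs → InWalk RY (T S) y cs → InducedAt y → InducedAt (walkEnd RY y cs)
      along []       _             induced = induced
      along (i ∷ cs) (t , in-tree) induced =
        along cs in-tree (InducedAt-trivial-dart (trivial _ i t) induced)

    σ-hom : PreservesConnectivity V → ∀ i x → σ (r RX i x) ≡ r RX i (σ x)
    σ-hom preserves i x with ζ-surjective V y₀ preserves (gen i)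
    ... | w , w-fixes-y₀ , w≈rᵢ = cong proj₁ (begin
      fun φ (r RX i x , y₀)          ≡⟨ cong (fun φ) (loop x) ⟨
      fun φ (act RXV w (x , y₀))     ≡⟨ Aut-act φ w (x , y₀) ⟩
      act RXV w (fun φ (x , y₀))     ≡⟨ cong (act RXV w) (induced-at-y₀ x) ⟩
      act RXV w (σ x , y₀)           ≡⟨ loop (σ x) ⟩
      (r RX i (σ x) , y₀)            ∎)
      where
      loop : ∀ x → act RXV w (x , y₀) ≡ (r RX i x , y₀)
      loop x = trans (act-⋊ X V w x y₀) (cong₂ _,_ (act-cong X w≈rᵢ x) w-fixes-y₀)

    σ-Aut : PreservesConnectivity V → Aut RX
    σ-Aut preserves = record
      { fun   = σ
      ; inv   = σ⁻¹
      ; left  = λ x → cong proj₁ (trans (cong (inv φ) (sym (induced-at-y₀ x))) (left φ (x , y₀)))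
      ; right = λ x → cong proj₁ (trans (cong (fun φ) (sym (inv-at-y₀ x))) (right φ (x , y₀)))
      ; hom   = σ-hom preserves
      }
      where
      σ⁻¹ : Flag RX → Flag RX
      σ⁻¹ x = proj₁ (inv φ (x , y₀))
      inv-at-y₀ : ∀ x → inv φ (x , y₀) ≡ (σ⁻¹ x , y₀)
      inv-at-y₀ x = cong (σ⁻¹ x ,_) (trans (sym (fibres (inv φ (x , y₀)))) (cong proj₂ (right φ (x , y₀))))

    fibre-preserving⇒induced : HasTrivialSpanningTree V y₀ → PreservesConnectivity V → InducedFromX X V φ
    fibre-preserving⇒induced tree preserves = σ-Aut preserves , λ x y → induced-everywhere tree y x

module _ {n m} (X : Premaniplex n) (x₀ : Flag (raw X)) (V : VoltageOp n m) (y₀ : Flag (raw (Y V))) where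
  private
    RY  = raw (Y V)
    RXV = X ⋊ V
    XV  = ⋊-premaniplex X V
    b   = (x₀ , y₀)

  ζPreimageN≐Stab : ζPreimageN X x₀ V y₀ ≐′ Stab RXV b
  ζPreimageN≐Stab = (λ h (hy , hx) → trans (act-⋊ X V h x₀ y₀) (cong₂ _,_ hx hy))
                  , (λ h s → let e = trans (sym (act-⋊ X V h x₀ y₀)) s in cong proj₂ e , cong proj₁ e)

  InNormaliser-ζPreimageN⇔ : ∀ g → InNormaliser (ζPreimageN X x₀ V y₀) g ⇔ (Stab RXV b ≐′ Stab RXV (act RXV (winv g) b))
  InNormaliser-ζPreimageN⇔ g = mk⇔
    (λ N → to (InNormaliser-Stab⇔ XV b g) (InNormaliser-cong ζPreimageN≐Stab g N))
    (λ e → InNormaliser-cong (swap ζPreimageN≐Stab) g (from (InNormaliser-Stab⇔ XV b g) e))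
    where open Equivalence

  winv-fixes-y₀⇔ : ∀ g → proj₂ (act RXV (winv g) b) ≡ y₀ ⇔ Stab RY y₀ g
  winv-fixes-y₀⇔ g = mk⇔ (λ e → to (Stab-winv (Y V) y₀ g) (trans (sym (proj₂-act-⋊ X V (winv g) b)) e))
                         (λ s → trans (proj₂-act-⋊ X V (winv g) b) (from (Stab-winv (Y V) y₀ g) s))
    where open Equivalence

  induced⇒NormInL : Connected RXV → (∀ (φ : Aut RXV) → InducedFromX X V φ) → NormInL X x₀ V y₀
  induced⇒NormInL connected induced g normalises
    with Stab≐⇒Aut XV connected (Equivalence.to (InNormaliser-ζPreimageN⇔ g) normalises)
  ... | ψ , ψb with induced ψ
  ... | _ , ψ-induced = Equivalence.to (winv-fixes-y₀⇔ g) (cong proj₂ (trans (sym ψb) (ψ-induced x₀ y₀)))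

  NormInL⇒induced : Connected (raw X) → HasTrivialSpanningTree V y₀ → PreservesConnectivity V →
                    NormInL X x₀ V y₀ → ∀ (φ : Aut RXV) → InducedFromX X V φ
  NormInL⇒induced X-connected tree preserves N⊆L φ =
    fibre-preserving⇒induced X V φ (Aut-preserves-fibres X V connected φ b φb-over-y₀) y₀ tree preserves
    where
    connected = preserves X X-connected
    g = path XV connected (fun φ b) b
    g⁻¹b≡φb : act RXV (winv g) b ≡ fun φ b
    g⁻¹b≡φb = act-winv-≡ XV g (act-path XV connected (fun φ b) b)
    g-normalises : InNormaliser (ζPreimageN X x₀ V y₀) g
    g-normalises = Equivalence.from (InNormaliser-ζPreimageN⇔ g)
      (subst (λ c → Stab RXV b ≐′ Stab RXV c) (sym g⁻¹b≡φb) (swap (Stab-Aut φ b)))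
    φb-over-y₀ : proj₂ (fun φ b) ≡ y₀
    φb-over-y₀ = trans (cong proj₂ (sym g⁻¹b≡φb)) (Equivalence.from (winv-fixes-y₀⇔ g) (N⊆L g g-normalises))

proposition5p4 : ∀ {n m : ℕ} (X : Premaniplex n) (x₀ : Flag (raw X)) →
    Connected (raw X) →
    (V : VoltageOp n m) (y₀ : Flag (raw (Y V))) →
    Connected (raw (Y V)) →
    HasTrivialSpanningTree V y₀ →
    ((Connected (X ⋊ V) → (∀ (φ : Aut (X ⋊ V)) → InducedFromX X V φ) →
      NormInL X x₀ V y₀)
    ×
     (PreservesConnectivity V → NormInL X x₀ V y₀ →
      ∀ (φ : Aut (X ⋊ V)) → InducedFromX X V φ))
proposition5p4 X x₀ X-connected V y₀ _ tree =
  induced⇒NormInL X x₀ V y₀ , NormInL⇒induced X x₀ V y₀ X-connected tree
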